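{- Let $q$ be an odd prime power. Then $\eta_1(\mathbb{F}_q\times\mathbb{F}_q)\le q+\eta_1(\mathbb{F}_q)$.
   Context: For an abelian group $G$ and positive integer $g$, $\eta_g(G)$ denotes the minimum size of a set $A\subseteq G$ such that for every $x\in G$ there are at least $g$ pairs $(a,a')\in A\times A$ with $a-a'=x$. Here $\mathbb{F}_q$ and $\mathbb{F}_q\times\mathbb{F}_q$ are regarded as additive groups. -}

module Defs where

open import Level using (0ℓ)
open import Data.Nat using (ℕ; _≤_; _^_; _%_; _+_)
open import Data.Nat.Primality using (Prime)
open import Data.Fin using (Fin)
open import Data.Product using (Σ; ∃; _×_; _,_; ∃-syntax)
open import Data.List using (List; length)
open import Data.List.Relation.Unary.Unique.Propositional using (Unique)
open import Data.List.Membership.Propositional using (_∈_)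
open import Relation.Binary.PropositionalEquality using (_≡_; _≢_)
open import Relation.Nullary using (¬_)
open import Function.Bundles using (_↔_)
import Algebra.Structures as AS

record FiniteField (q : ℕ) : Set₁ where
  field
    Carrier : Set
    _+ᶠ_ _*ᶠ_ : Carrier → Carrier → Carrier
    -ᶠ_ : Carrier → Carrier
    0ᶠ 1ᶠ : Carrier
    isCommutativeRing : AS.IsCommutativeRing {A = Carrier} _≡_ _+ᶠ_ _*ᶠ_ -ᶠ_ 0ᶠ 1ᶠ
    0≢1 : 0ᶠ ≢ 1ᶠ
    inverse : ∀ x → x ≢ 0ᶠ → ∃[ y ] (x *ᶠ y ≡ 1ᶠ)
    card : Carrier ↔ Fin q

  _-ᶠ_ : Carrier → Carrier → Carrier
  x -ᶠ y = x +ᶠ (-ᶠ y)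

-- Additive group data: a carrier with its subtraction.
-- A finite set A ⊆ G is represented by a duplicate-free list.
-- A is a difference basis (g = 1) if every x ∈ G is a - a' with a, a' ∈ A.
IsDiffBasis : (G : Set) → (G → G → G) → List G → Set
IsDiffBasis G _-_ A = ∀ (x : G) → ∃[ a ] ∃[ a' ] (a ∈ A × a' ∈ A × (a - a') ≡ x)

IsEta₁ : (G : Set) → (G → G → G) → ℕ → Set
IsEta₁ G _-_ m =
  (∃[ A ] (Unique A × IsDiffBasis G _-_ A × length A ≡ m)) ×
  (∀ (A : List G) → Unique A → IsDiffBasis G _-_ A → m ≤ length A)

addF : ∀ {q} (F : FiniteField q) → Σ Set (λ G → G → G → G)
addF F = Carrier , _-ᶠ_
  where open FiniteField F

addF² : ∀ {q} (F : FiniteField q) → Σ Set (λ G → G → G → G)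
addF² F = (Carrier × Carrier) , λ { (a , b) (c , d) → (a -ᶠ c , b -ᶠ d) }
  where open FiniteField F

η₁[_]≡_ : Σ Set (λ G → G → G → G) → ℕ → Set
η₁[ (G , s) ]≡ m = IsEta₁ G s m

OddPrimePower : ℕ → Set
OddPrimePower q = (∃[ p ] ∃[ k ] (Prime p × 1 ≤ k × q ≡ p ^ k)) × (q % 2 ≡ 1)

-- Take A = {(x, x²) : x ∈ F} ∪ ({0} × B) for a minimum difference basis B of F. Differences
-- (0, e) come from {0} × B. For d ≠ 0, (d, e) is the chord of the parabola from
-- y = (e/d − d)/2 to x = (e/d + d)/2, since x − y = d and x² − y² = (x − y)(x + y) = e.
-- Halving is possible because a field of odd order has 1 + 1 ≠ 0: otherwise x ↦ x + 1
-- would be a fixed-point-free involution, splitting the q elements into pairs.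
module Submission where

open import Algebra.Bundles using (CommutativeRing)
open import Data.Product using (∃-syntax; _×_; _,_)
import Algebra.Properties.AbelianGroup as AbelianGroupProperties
import Algebra.Solver.Ring.NaturalCoefficients.Default as SemiringSolver
import Relation.Binary.Reasoning.Setoid as SetoidReasoning

module _ {c ℓ} (R : CommutativeRing c ℓ) where
  open CommutativeRing R
  open SetoidReasoning setoid
  open SemiringSolver commutativeSemiring
  open AbelianGroupProperties +-abelianGroup using (xyx⁻¹≈y)

  y+d≈x⇒x-y≈d : ∀ {x y d} → y + d ≈ x → x - y ≈ d
  y+d≈x⇒x-y≈d {x} {y} {d} y+d≈x = begin
    x - y       ≈⟨ +-congʳ y+d≈x ⟨
    y + d - y   ≈⟨ xyx⁻¹≈y y d ⟩
    d           ∎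

  -- The chord is x = (e/d + d)/2, y = (e/d − d)/2. The solver used has natural
  -- coefficients, so −d is named n and only ever cancelled through d + n ≈ 0.
  parabola-chord : ∀ {h} → h + h ≈ 1# → ∀ {d d⁻¹} → d * d⁻¹ ≈ 1# → ∀ e →
                   ∃[ x ] ∃[ y ] (x - y ≈ d × x * x - y * y ≈ e)
  parabola-chord {h} h+h≈1 {d} {d⁻¹} dd⁻¹≈1 e =
    x , y , y+d≈x⇒x-y≈d y+d≈x , y+d≈x⇒x-y≈d y²+e≈x²
    where
    s n x y : Carrier
    s = e * d⁻¹
    n = - d
    x = (s + d) * h
    y = (s + n) * h

    +-annihilate : ∀ z a → z + a * (d + n) ≈ z
    +-annihilate z a = begin
      z + a * (d + n) ≈⟨ +-congˡ (*-congˡ (-‿inverseʳ d)) ⟩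
      z + a * 0#      ≈⟨ +-congˡ (zeroʳ a) ⟩
      z + 0#          ≈⟨ +-identityʳ z ⟩
      z               ∎

    d*s≈e : d * s ≈ e
    d*s≈e = begin
      d * (e * d⁻¹) ≈⟨ solve 3 (λ d e d⁻¹ → d :* (e :* d⁻¹) := e :* (d :* d⁻¹)) refl d e d⁻¹ ⟩
      e * (d * d⁻¹) ≈⟨ *-congˡ dd⁻¹≈1 ⟩
      e * 1#        ≈⟨ *-identityʳ e ⟩
      e             ∎

    e≈4ds : e ≈ d * s * ((h + h) * (h + h))
    e≈4ds = begin
      e                             ≈⟨ d*s≈e ⟨
      d * s                         ≈⟨ *-identityʳ (d * s) ⟨
      d * s * 1#                    ≈⟨ *-congˡ (*-identityʳ 1#) ⟨
      d * s * (1# * 1#)             ≈⟨ *-congˡ (*-cong h+h≈1 h+h≈1) ⟨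
      d * s * ((h + h) * (h + h))   ∎

    y+d≈x : y + d ≈ x
    y+d≈x = begin
      y + d             ≈⟨ +-congˡ (*-identityʳ d) ⟨
      y + d * 1#        ≈⟨ +-congˡ (*-congˡ h+h≈1) ⟨
      y + d * (h + h)   ≈⟨ solve 4 (λ s d n h → (s :+ n) :* h :+ d :* (h :+ h)
                                                := (s :+ d) :* h :+ h :* (d :+ n)) refl s d n h ⟩
      x + h * (d + n)   ≈⟨ +-annihilate x h ⟩
      x                 ∎

    y²+e≈x² : y * y + e ≈ x * x
    y²+e≈x² = begin
      y * y + e                                                     ≈⟨ +-annihilate _ (d * h * h) ⟨
      y * y + e + d * h * h * (d + n)                               ≈⟨ +-congʳ (+-congˡ e≈4ds) ⟩
      y * y + d * s * ((h + h) * (h + h)) + d * h * h * (d + n)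
        ≈⟨ solve 4 (λ s d n h → (s :+ n) :* h :* ((s :+ n) :* h) :+ d :* s :* ((h :+ h) :* (h :+ h))
                                  :+ d :* h :* h :* (d :+ n)
                                := (s :+ d) :* h :* ((s :+ d) :* h) :+ (s :+ s :+ n) :* h :* h :* (d :+ n))
                   refl s d n h ⟩
      x * x + (s + s + n) * h * h * (d + n)                         ≈⟨ +-annihilate _ _ ⟩
      x * x                                                         ∎

open import Defs
open import Data.Nat using (ℕ; zero; suc; _+_; _≤_; _%_)
open import Data.Nat.Properties using (≤-trans; suc-injective; 1+n≢0; module ≤-Reasoning)
open import Data.Nat.Divisibility using (_∣_; _∣0; ∣-refl; ∣m∣n⇒∣m+n; n∣m⇒m%n≡0)
import Data.Fin as Fin
open import Data.Product using (proj₂)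
open import Data.Product.Properties using (≡-dec)
open import Data.Empty using (⊥-elim)
open import Data.List using (List; []; _∷_; length; map; _++_; filter; allFin; deduplicate)
open import Data.List.Properties
  using (length-map; length-++; length-tabulate; length-deduplicate; filter-accept; filter-reject; filter-all)
open import Data.List.Relation.Unary.Any using (here; there)
import Data.List.Relation.Unary.All as All
open import Data.List.Relation.Unary.AllPairs using (_∷_)
open import Data.List.Relation.Unary.Unique.Propositional using (Unique)
import Data.List.Relation.Unary.Unique.Propositional.Properties as Unique
open import Data.List.Relation.Unary.Unique.DecPropositional.Properties using (deduplicate-!)
open import Data.List.Membership.Propositional using (_∈_)
open import Data.List.Membership.Propositional.Properties
  using (∈-map⁺; ∈-allFin; ∈-++⁺ˡ; ∈-++⁺ʳ; ∈-deduplicate⁺; ∈-filter⁺; ∈-filter⁻)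
open import Relation.Binary.PropositionalEquality using (_≡_; _≢_; refl; sym; trans; cong; cong₂; subst; ≢-sym)
open import Relation.Binary.Definitions using (DecidableEquality)
open import Relation.Nullary using (yes; no; ¬?)
open import Relation.Nullary.Decidable using (via-injection)
open import Function using (_∘′_)
open import Function.Bundles using (Inverse)
open import Function.Properties.Inverse using (↔⇒↣)

module _ {a} {A : Set a} (_≟_ : DecidableEquality A) where

  _without_ : List A → A → List A
  xs without x = filter (λ y → ¬? (y ≟ x)) xs

  length-without : ∀ {x xs} → Unique xs → x ∈ xs → suc (length (xs without x)) ≡ length xs
  length-without {xs = y ∷ ys} (y∉ys ∷ _) (here refl) =
    cong (suc ∘′ length) (trans (filter-reject ≢y? (λ y≢y → y≢y refl)) (filter-all ≢y? (All.map ≢-sym y∉ys)))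
    where ≢y? = λ z → ¬? (z ≟ y)
  length-without {x} {y ∷ ys} (y∉ys ∷ ys!) (there x∈ys) =
    cong suc (trans (cong length (filter-accept (λ z → ¬? (z ≟ x)) (All.lookup y∉ys x∈ys)))
                    (length-without ys! x∈ys))

  module _ (σ : A → A) (σ-involutive : ∀ x → σ (σ x) ≡ x) (σ-fixpointFree : ∀ x → σ x ≢ x) where

    σ-injective : ∀ {x y} → σ x ≡ σ y → x ≡ y
    σ-injective {x} {y} σx≡σy = trans (sym (σ-involutive x)) (trans (cong σ σx≡σy) (σ-involutive y))

    -- The closed list x ∷ ys loses the pair {x, σ x} and stays closed under σ.
    2∣length-of-σ-closed : ∀ n {xs} → length xs ≡ n → Unique xs → (∀ {y} → y ∈ xs → σ y ∈ xs) → 2 ∣ n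
    2∣length-of-σ-closed zero _ _ _ = 2 ∣0
    2∣length-of-σ-closed (suc n) {[]} ()
    2∣length-of-σ-closed (suc zero) {_ ∷ _ ∷ _} ()
    2∣length-of-σ-closed (suc zero) {x ∷ []} _ _ closed with closed (here refl)
    ... | here σx≡x = ⊥-elim (σ-fixpointFree x σx≡x)
    2∣length-of-σ-closed (suc (suc n)) {x ∷ ys} |xs| (x∉ys ∷ ys!) closed with closed (here refl)
    ... | here σx≡x = ⊥-elim (σ-fixpointFree x σx≡x)
    ... | there σx∈ys = ∣m∣n⇒∣m+n ∣-refl (2∣length-of-σ-closed n |ys'| (Unique.filter⁺ _ ys!) closed')
      where
      ys' = ys without σ x

      |ys'| : length ys' ≡ n
      |ys'| = suc-injective (trans (length-without ys! σx∈ys) (suc-injective |xs|))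

      closed' : ∀ {y} → y ∈ ys' → σ y ∈ ys'
      closed' {y} y∈ys' with ∈-filter⁻ _ y∈ys'
      ... | y∈ys , y≢σx with closed (there y∈ys)
      ... | here σy≡x = ⊥-elim (y≢σx (trans (sym (σ-involutive y)) (cong σ σy≡x)))
      ... | there σy∈ys = ∈-filter⁺ _ σy∈ys (λ σy≡σx → All.lookup x∉ys y∈ys (sym (σ-injective σy≡σx)))

isEta₁⇒≤-length : ∀ {G _-_ m} → DecidableEquality G → IsEta₁ G _-_ m →
                  ∀ A → IsDiffBasis G _-_ A → m ≤ length A
isEta₁⇒≤-length _≟_ (_ , minimal) A A-basis =
  ≤-trans (minimal (deduplicate _≟_ A) (deduplicate-! _≟_ A) dedup-basis) (length-deduplicate _≟_ A)
  where
  dedup-basis : IsDiffBasis _ _ (deduplicate _≟_ A)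
  dedup-basis x with A-basis x
  ... | a , a' , a∈A , a'∈A , a-a'≡x = a , a' , ∈-deduplicate⁺ _≟_ a∈A , ∈-deduplicate⁺ _≟_ a'∈A , a-a'≡x

module FiniteFieldProperties {q} (F : FiniteField q) where
  open FiniteField F
  open Inverse card using (to; from; strictlyInverseˡ; strictlyInverseʳ)

  ring : CommutativeRing _ _
  ring = record { isCommutativeRing = isCommutativeRing }

  open CommutativeRing ring using (+-identityʳ; +-assoc; -‿inverseʳ; *-identityˡ; distribʳ)
  open AbelianGroupProperties (CommutativeRing.+-abelianGroup ring) using (identityʳ-unique)

  _≟_ : DecidableEquality Carrier
  _≟_ = via-injection (↔⇒↣ card) Fin._≟_

  elements : List Carrier
  elements = map from (allFin q)

  elements-unique : Unique elements
  elements-unique = Unique.map⁺ from-injective (Unique.allFin⁺ q)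
    where
    from-injective : ∀ {i j} → from i ≡ from j → i ≡ j
    from-injective {i} {j} eq = trans (sym (strictlyInverseˡ i)) (trans (cong to eq) (strictlyInverseˡ j))

  ∈-elements : ∀ x → x ∈ elements
  ∈-elements x = subst (_∈ elements) (strictlyInverseʳ x) (∈-map⁺ from (∈-allFin (to x)))

  length-elements : length elements ≡ q
  length-elements = trans (length-map from (allFin q)) (length-tabulate _)

  1+1≡0⇒2∣q : 1ᶠ +ᶠ 1ᶠ ≡ 0ᶠ → 2 ∣ q
  1+1≡0⇒2∣q 1+1≡0 =
    2∣length-of-σ-closed _≟_ (_+ᶠ 1ᶠ) +1-involutive +1-fixpointFree q length-elements elements-unique
      (λ {y} _ → ∈-elements (y +ᶠ 1ᶠ))
    where
    +1-involutive : ∀ x → (x +ᶠ 1ᶠ) +ᶠ 1ᶠ ≡ x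
    +1-involutive x = trans (+-assoc x 1ᶠ 1ᶠ) (trans (cong (x +ᶠ_) 1+1≡0) (+-identityʳ x))

    +1-fixpointFree : ∀ x → x +ᶠ 1ᶠ ≢ x
    +1-fixpointFree x x+1≡x = 0≢1 (sym (identityʳ-unique x 1ᶠ x+1≡x))

  1+1≢0 : q % 2 ≡ 1 → 1ᶠ +ᶠ 1ᶠ ≢ 0ᶠ
  1+1≢0 q-odd 1+1≡0 = 1+n≢0 (trans (sym q-odd) (n∣m⇒m%n≡0 q 2 (1+1≡0⇒2∣q 1+1≡0)))

  half : q % 2 ≡ 1 → ∃[ h ] (h +ᶠ h ≡ 1ᶠ)
  half q-odd = let h , 2h≡1 = inverse (1ᶠ +ᶠ 1ᶠ) (1+1≢0 q-odd) in
    h , trans (cong₂ _+ᶠ_ (sym (*-identityˡ h)) (sym (*-identityˡ h))) (trans (sym (distribʳ h 1ᶠ 1ᶠ)) 2h≡1)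

  _≟²_ : DecidableEquality (Carrier × Carrier)
  _≟²_ = ≡-dec _≟_ _≟_

  parabola∪axis : List Carrier → List (Carrier × Carrier)
  parabola∪axis B = map (λ x → x , x *ᶠ x) elements ++ map (0ᶠ ,_) B

  length-parabola∪axis : ∀ B → length (parabola∪axis B) ≡ q + length B
  length-parabola∪axis B = trans (length-++ (map _ elements))
    (cong₂ _+_ (trans (length-map _ elements) length-elements) (length-map _ B))

  parabola∪axis-isDiffBasis : q % 2 ≡ 1 → ∀ {B} → IsDiffBasis Carrier _-ᶠ_ B →
                              IsDiffBasis (Carrier × Carrier) (proj₂ (addF² F)) (parabola∪axis B)
  parabola∪axis-isDiffBasis q-odd {B} B-basis (d , e) with d ≟ 0ᶠ
  ... | yes refl = let b , b' , b∈B , b'∈B , b-b'≡e = B-basis e in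
    (0ᶠ , b) , (0ᶠ , b') , on-axis b∈B , on-axis b'∈B , cong₂ _,_ (-‿inverseʳ 0ᶠ) b-b'≡e
    where
    on-axis : ∀ {b} → b ∈ B → (0ᶠ , b) ∈ parabola∪axis B
    on-axis b∈B = ∈-++⁺ʳ _ (∈-map⁺ _ b∈B)
  ... | no d≢0 = let h , h+h≡1 = half q-odd
                     d⁻¹ , dd⁻¹≡1 = inverse d d≢0
                     x , y , x-y≡d , x²-y²≡e = parabola-chord ring h+h≡1 dd⁻¹≡1 e in
    (x , x *ᶠ x) , (y , y *ᶠ y) , on-parabola x , on-parabola y , cong₂ _,_ x-y≡d x²-y²≡e
    where
    on-parabola : ∀ x → (x , x *ᶠ x) ∈ parabola∪axis B
    on-parabola x = ∈-++⁺ˡ (∈-map⁺ _ (∈-elements x))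

lemma6 : ∀ (q : ℕ) → OddPrimePower q → (F : FiniteField q) →
    ∀ (m m' : ℕ) → η₁[ addF² F ]≡ m → η₁[ addF F ]≡ m' → m ≤ q + m'
lemma6 q (_ , q-odd) F m m' m-isEta₁ ((B , _ , B-basis , |B|≡m') , _) = begin
  m                         ≤⟨ isEta₁⇒≤-length _≟²_ m-isEta₁ A (parabola∪axis-isDiffBasis q-odd B-basis) ⟩
  length A                  ≡⟨ length-parabola∪axis B ⟩
  q + length B              ≡⟨ cong (q +_) |B|≡m' ⟩
  q + m'                    ∎
  where
  open FiniteFieldProperties F
  open ≤-Reasoning
  A = parabola∪axis B
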